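{- Let $p \ge 7$ be prime and $s$ a positive integer. Let $(r_1,r_2,q)$ be one of the six tuples $\left(\tfrac12,\tfrac12,\tfrac43\right), \left(\tfrac12,\tfrac12,\tfrac76\right), \left(\tfrac12,\tfrac13,\tfrac76\right), \left(\tfrac12,\tfrac13,\tfrac54\right), \left(\tfrac12,\tfrac14,\tfrac76\right), \left(\tfrac12,\tfrac12,\tfrac54\right)$, and set \[ H(k) = \frac{(r_1)_k(1-r_1)_k(r_2)_k(1-r_2)_k}{(1)_k(1)_k(q)_k(2-q)_k}. \] Then $p^s H(k) \in \mathbb{Z}_p$ for all integers $0 \le k \le p^s-1$. In particular $p^s F_s \in \mathbb{Z}_p$, where $F_s = \sum_{k=0}^{p^s-1} H(k)$.
   Context: $(x)_k = x(x+1)\cdots(x+k-1)$ with $(x)_0=1$. -}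

module Defs where

open import Data.Nat as ℕ using (ℕ; zero; suc)
open import Data.Nat.Divisibility using (_∣_)
open import Data.Integer using (ℤ; +_)
open import Data.Rational using (ℚ; 0ℚ; 1ℚ; _+_; _-_; _*_; _/_; 1/_; ≢-nonZero)
open import Data.Rational.Properties using (_≟_)
open import Data.Product using (_×_; _,_)
open import Data.List using (List; []; _∷_)
open import Relation.Nullary using (¬_; yes; no)

ℕtoℚ : ℕ → ℚ
ℕtoℚ n = (+ n) / 1

poch : ℚ → ℕ → ℚ
poch x zero = 1ℚ
poch x (suc k) = poch x k * (x + ℕtoℚ k)

-- total division: x ÷ y, with the (never used here) convention x ÷ 0 = 0
_÷'_ : ℚ → ℚ → ℚ
x ÷' y with y ≟ 0ℚ
... | yes _ = 0ℚ
... | no y≢0 = x * (1/_ y {{≢-nonZero y≢0}})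

H : ℚ → ℚ → ℚ → ℕ → ℚ
H r₁ r₂ q k =
  (poch r₁ k * poch (1ℚ - r₁) k * poch r₂ k * poch (1ℚ - r₂) k)
  ÷' (poch 1ℚ k * poch 1ℚ k * poch q k * poch ((+ 2) / 1 - q) k)

sumTo : ℕ → (ℕ → ℚ) → ℚ
sumTo zero f = 0ℚ
sumTo (suc n) f = sumTo n f + f n

F : ℕ → ℕ → ℚ → ℚ → ℚ → ℚ
F p s r₁ r₂ q = sumTo (p ℕ.^ s) (H r₁ r₂ q)

_∈ℤ[_] : ℚ → ℕ → Set
x ∈ℤ[ p ] = ¬ (p ∣ ℚ.denominatorℕ x)

sixTuples : List (ℚ × ℚ × ℚ)
sixTuples =
    ((+ 1) / 2 , (+ 1) / 2 , (+ 4) / 3)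
  ∷ ((+ 1) / 2 , (+ 1) / 2 , (+ 7) / 6)
  ∷ ((+ 1) / 2 , (+ 1) / 3 , (+ 7) / 6)
  ∷ ((+ 1) / 2 , (+ 1) / 3 , (+ 5) / 4)
  ∷ ((+ 1) / 2 , (+ 1) / 4 , (+ 7) / 6)
  ∷ ((+ 1) / 2 , (+ 1) / 2 , (+ 5) / 4)
  ∷ []

module Submission where

-- For r = n/d one has (r)_k d^k = n (n + d) ⋯ (n + d(k - 1)), and all the denominators d are at most 6,
-- hence prime to p; so the claim is an inequality between p-adic valuations of products of arithmetic
-- progressions. By Legendre's argument the valuation of ∏_{j<k} (n + d j) is the sum over e ≥ 1 of the number
-- N_e of j < k with p^e ∣ n + d j. As d is invertible modulo M = p^e this congruence has a single root c < M,
-- and N_e = ⌊k/M⌋ + [c < k mod M]. The roots c, c′ of r₁ and 1 - r₁ satisfy c + c′ + 1 ≡ 0 (mod M), those of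
-- q and 2 - q satisfy c + c′ + 2 ≡ 0, and comparing them with k mod M shows that at every level the count for
-- the denominator exceeds the count for the numerator by at most one. Levels with p^e > p^s do not count at all,
-- since then no factor of the denominator is divisible by p^e; hence v_p(denominator) ≤ s + v_p(numerator).

open import Defs

module Arithmetic where

  open import Data.Nat
    using (ℕ; zero; suc; _+_; _*_; _^_; _∸_; _⊓_; pred; _≤_; _<_; _≟_; _≤?_; _<?_; _≤ᵇ_; _<ᵇ_; z≤n; s≤s;
           NonZero; NonTrivial; ≢-nonZero; >-nonZero; nonTrivial⇒nonZero; nonTrivial⇒≢1; nonTrivial⇒n>1)
  open import Data.Nat.Properties
  open import Data.Nat.DivMod using (_%_; _/_; m≡m%n+[m/n]*n; [m+kn]%n≡m%n; m<n⇒m%n≡m; m%n≤n; m%n<n)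
  open import Data.Nat.Divisibility
    using (_∣_; _∤_; _∣?_; divides; ∣-refl; ∣-trans; ∣1⇒≡1; ∣⇒≤; quotient-<; *-cancelˡ-∣; *-monoʳ-∣;
           ∣m+n∣m⇒∣n; ∣m∣n⇒∣m+n; n∣m*n; ∣n⇒∣m*n)
  open import Data.Nat.Coprimality as Coprimality
    using (Coprime; coprime-Bézout; coprime-divisor; 1-coprimeTo; prime⇒coprime)
  open import Data.Nat.GCD using (module Bézout)
  open import Data.Nat.Primality using (Prime; euclidsLemma; prime⇒nonTrivial)
  open import Data.Nat.Induction using (<-rec)
  open import Data.Nat.Tactic.RingSolver using (solve-∀)
  open import Algebra.Properties.CommutativeSemigroup +-commutativeSemigroup
    using () renaming (interchange to +-interchange)
  open import Algebra.Properties.CommutativeSemigroup *-commutativeSemigroup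
    using () renaming (interchange to *-interchange)
  open import Data.Bool.Base using (T)
  open import Data.Product using (∃-syntax; _×_; _,_)
  open import Data.Sum using ([_,_]′; inj₁; inj₂)
  open import Function using (_∘_)
  open import Function.Bundles using (_⇔_; mk⇔; Equivalence)
  open import Relation.Nullary using (¬_; Dec; yes; no; contradiction)
  open import Relation.Binary.PropositionalEquality

  -- Indicators and finite sums

  𝟙 : {P : Set} → Dec P → ℕ
  𝟙 (yes _) = 1
  𝟙 (no _) = 0

  𝟙-yes : {P : Set} (P? : Dec P) → P → 𝟙 P? ≡ 1
  𝟙-yes (yes _) p = refl
  𝟙-yes (no ¬p) p = contradiction p ¬p

  𝟙-no : {P : Set} (P? : Dec P) → ¬ P → 𝟙 P? ≡ 0
  𝟙-no (yes p) ¬p = contradiction p ¬p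
  𝟙-no (no _) ¬p = refl

  𝟙≤1 : {P : Set} (P? : Dec P) → 𝟙 P? ≤ 1
  𝟙≤1 (yes _) = ≤-refl
  𝟙≤1 (no _) = z≤n

  𝟙-cong : {P Q : Set} (P? : Dec P) (Q? : Dec Q) → P ⇔ Q → 𝟙 P? ≡ 𝟙 Q?
  𝟙-cong P? (yes q) P⇔Q = 𝟙-yes P? (Equivalence.from P⇔Q q)
  𝟙-cong P? (no ¬q) P⇔Q = 𝟙-no P? (λ p → ¬q (Equivalence.to P⇔Q p))

  𝟙-<-suc : ∀ c r → 𝟙 (c <? r) + 𝟙 (r ≟ c) ≡ 𝟙 (c <? suc r)
  𝟙-<-suc c r with c <? r | r ≟ c
  ... | yes c<r | yes refl = contradiction c<r (<-irrefl refl)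
  ... | yes c<r | no _ = sym (𝟙-yes (c <? suc r) (m<n⇒m<1+n c<r))
  ... | no _ | yes refl = sym (𝟙-yes (c <? suc r) ≤-refl)
  ... | no c≮r | no r≢c = sym (𝟙-no (c <? suc r) (λ c<1+r → [ c≮r , r≢c ∘ sym ]′ (m<1+n⇒m<n∨m≡n c<1+r)))

  ∑ : ℕ → (ℕ → ℕ) → ℕ
  ∑ zero f = 0
  ∑ (suc n) f = ∑ n f + f n

  ∏ : ℕ → (ℕ → ℕ) → ℕ
  ∏ zero f = 1
  ∏ (suc n) f = ∏ n f * f n

  syntax ∑ n (λ j → f) = ∑[ j < n ] f
  syntax ∏ n (λ j → f) = ∏[ j < n ] f

  module _ {f g : ℕ → ℕ} where

    ∑-cong : ∀ n → (∀ {j} → j < n → f j ≡ g j) → ∑ n f ≡ ∑ n g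
    ∑-cong zero f≡g = refl
    ∑-cong (suc n) f≡g = cong₂ _+_ (∑-cong n (λ j<n → f≡g (m<n⇒m<1+n j<n))) (f≡g ≤-refl)

    ∑-mono-≤ : ∀ n → (∀ {j} → j < n → f j ≤ g j) → ∑ n f ≤ ∑ n g
    ∑-mono-≤ zero f≤g = z≤n
    ∑-mono-≤ (suc n) f≤g = +-mono-≤ (∑-mono-≤ n (λ j<n → f≤g (m<n⇒m<1+n j<n))) (f≤g ≤-refl)

    ∑-+ : ∀ n → ∑[ j < n ] (f j + g j) ≡ ∑ n f + ∑ n g
    ∑-+ zero = refl
    ∑-+ (suc n) = trans (cong (_+ (f n + g n)) (∑-+ n)) (+-interchange (∑ n f) (∑ n g) (f n) (g n))

  ∑-zero : ∀ n → ∑[ j < n ] 0 ≡ 0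
  ∑-zero zero = refl
  ∑-zero (suc n) = trans (+-identityʳ _) (∑-zero n)

  ∑-+₄ : ∀ E (f g h i : ℕ → ℕ) →
         ∑[ e < E ] (f e + g e + h e + i e) ≡ ∑ E f + ∑ E g + ∑ E h + ∑ E i
  ∑-+₄ E f g h i = trans (∑-+ E) (cong (_+ ∑ E i) (trans (∑-+ E) (cong (_+ ∑ E h) (∑-+ E))))

  ∑-𝟙-< : ∀ a E → ∑[ e < E ] 𝟙 (e <? a) ≡ E ⊓ a
  ∑-𝟙-< a zero = refl
  ∑-𝟙-< a (suc E) with E <? a
  ... | yes E<a = begin
    ∑[ e < E ] 𝟙 (e <? a) + 1 ≡⟨ cong (_+ 1) (trans (∑-𝟙-< a E) (m≤n⇒m⊓n≡m (<⇒≤ E<a))) ⟩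
    E + 1                     ≡⟨ trans (+-comm E 1) (sym (m≤n⇒m⊓n≡m E<a)) ⟩
    suc E ⊓ a                 ∎
    where open ≡-Reasoning
  ... | no E≮a = begin
    ∑[ e < E ] 𝟙 (e <? a) + 0 ≡⟨ trans (+-identityʳ _) (∑-𝟙-< a E) ⟩
    E ⊓ a                     ≡⟨ m≥n⇒m⊓n≡n (≮⇒≥ E≮a) ⟩
    a                         ≡⟨ sym (m≥n⇒m⊓n≡n (m≤n⇒m≤1+n (≮⇒≥ E≮a))) ⟩
    suc E ⊓ a                 ∎
    where open ≡-Reasoning

  -- Exact powers of a prime

  infix 4 _^_∥_

  record _^_∥_ (p a n : ℕ) : Set where
    constructor exactly
    field
      cofactor : ℕ
      n≡p^a*cofactor : n ≡ p ^ a * cofactor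
      p∤cofactor : p ∤ cofactor

  ^-monoʳ-∣ : ∀ m {a b} → a ≤ b → m ^ a ∣ m ^ b
  ^-monoʳ-∣ m {a} {b} a≤b = divides (m ^ (b ∸ a)) (begin
    m ^ b             ≡⟨ cong (m ^_) (sym (m∸n+n≡m a≤b)) ⟩
    m ^ (b ∸ a + a)   ≡⟨ ^-distribˡ-+-* m (b ∸ a) a ⟩
    m ^ (b ∸ a) * m ^ a ∎)
    where open ≡-Reasoning

  module ExactPower {p : ℕ} (p-prime : Prime p) where

    private instance
      p-nonTrivial : NonTrivial p
      p-nonTrivial = prime⇒nonTrivial p-prime
      p-nonZero : NonZero p
      p-nonZero = nonTrivial⇒nonZero p

    p∤1 : p ∤ 1
    p∤1 p∣1 = nonTrivial⇒≢1 (∣1⇒≡1 p∣1)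

    ∥-unit : ∀ {n} → p ∤ n → p ^ 0 ∥ n
    ∥-unit {n} p∤n = exactly n (sym (+-identityʳ n)) p∤n

    ∥-* : ∀ {a b m n} → p ^ a ∥ m → p ^ b ∥ n → p ^ (a + b) ∥ m * n
    ∥-* {a} {b} {m} {n} (exactly v m≡ p∤v) (exactly w n≡ p∤w) =
      exactly (v * w) mn≡ ([ p∤v , p∤w ]′ ∘ euclidsLemma v w p-prime)
      where
      mn≡ : m * n ≡ p ^ (a + b) * (v * w)
      mn≡ = begin
        m * n                     ≡⟨ cong₂ _*_ m≡ n≡ ⟩
        p ^ a * v * (p ^ b * w)   ≡⟨ *-interchange (p ^ a) v (p ^ b) w ⟩
        p ^ a * p ^ b * (v * w)   ≡⟨ cong (_* (v * w)) (sym (^-distribˡ-+-* p a b)) ⟩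
        p ^ (a + b) * (v * w)     ∎
        where open ≡-Reasoning

    ∥-exists : ∀ n → n ≢ 0 → ∃[ a ] p ^ a ∥ n
    ∥-exists = <-rec (λ n → n ≢ 0 → ∃[ a ] p ^ a ∥ n) step
      where
      step : ∀ n → (∀ {m} → m < n → m ≢ 0 → ∃[ a ] p ^ a ∥ m) → n ≢ 0 → ∃[ a ] p ^ a ∥ n
      step n rec n≢0 with p ∣? n
      ... | no p∤n = 0 , ∥-unit p∤n
      ... | yes p∣n@(divides q n≡q*p) with rec (quotient-< p∣n {{p-nonTrivial}} {{≢-nonZero n≢0}}) q≢0
        where q≢0 : q ≢ 0
              q≢0 refl = n≢0 n≡q*p
      ... | a , exactly w q≡ p∤w = suc a , exactly w n≡ p∤w
        where
        n≡ : n ≡ p ^ suc a * w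
        n≡ = begin
          n                 ≡⟨ n≡q*p ⟩
          q * p             ≡⟨ cong (_* p) q≡ ⟩
          p ^ a * w * p     ≡⟨ *-comm (p ^ a * w) p ⟩
          p * (p ^ a * w)   ≡⟨ sym (*-assoc p (p ^ a) w) ⟩
          p ^ suc a * w     ∎
          where open ≡-Reasoning

    ∥⇒∣ : ∀ {a n} → p ^ a ∥ n → p ^ a ∣ n
    ∥⇒∣ {a} (exactly w n≡ _) = divides w (trans n≡ (*-comm (p ^ a) w))

    ∥⇒^∣⇔≤ : ∀ {a n} → p ^ a ∥ n → ∀ e → p ^ e ∣ n ⇔ e ≤ a
    ∥⇒^∣⇔≤ {a} {n} p^a∥n@(exactly w n≡ p∤w) e = mk⇔ to from
      where
      to : p ^ e ∣ n → e ≤ a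
      to p^e∣n with e ≤? a
      ... | yes e≤a = e≤a
      ... | no e≰a = contradiction p∣w p∤w
        where
        p^a*p∣p^a*w : p ^ a * p ∣ p ^ a * w
        p^a*p∣p^a*w = subst₂ _∣_ (*-comm p (p ^ a)) n≡ (∣-trans (^-monoʳ-∣ p (≰⇒> e≰a)) p^e∣n)
        p∣w : p ∣ w
        p∣w = *-cancelˡ-∣ (p ^ a) {{m^n≢0 p a}} p^a*p∣p^a*w
      from : e ≤ a → p ^ e ∣ n
      from e≤a = ∣-trans (^-monoʳ-∣ p e≤a) (∥⇒∣ p^a∥n)

    n<p^n : ∀ n → n < p ^ n
    n<p^n zero = s≤s z≤n
    n<p^n (suc n) = ≤-<-trans (n<p^n n) (^-monoʳ-< p (nonTrivial⇒n>1 p) (n<1+n n))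

    cofactor≢0 : ∀ {a n} (p^a∥n : p ^ a ∥ n) → _^_∥_.cofactor p^a∥n ≢ 0
    cofactor≢0 (exactly w _ p∤w) refl = p∤w (divides 0 refl)

    ∥⇒≢0 : ∀ {a n} → p ^ a ∥ n → n ≢ 0
    ∥⇒≢0 {a} p^a∥n@(exactly w n≡ _) n≡0 =
      cofactor≢0 p^a∥n (m*n≡0⇒m≡0 w (p ^ a) {{m^n≢0 p a}} (trans (*-comm w (p ^ a)) (trans (sym n≡) n≡0)))

    ∥⇒≤ : ∀ {a n} → p ^ a ∥ n → a ≤ n
    ∥⇒≤ {a} {n} p^a∥n@(exactly w n≡ _) = begin
      a          ≤⟨ <⇒≤ (n<p^n a) ⟩
      p ^ a      ≤⟨ m≤m*n (p ^ a) w {{≢-nonZero (cofactor≢0 p^a∥n)}} ⟩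
      p ^ a * w  ≡⟨ sym n≡ ⟩
      n          ∎
      where open ≤-Reasoning

    ∑-𝟙-∣-∥ : ∀ {a n} → p ^ a ∥ n → ∀ E → a ≤ E → ∑[ e < E ] 𝟙 (p ^ suc e ∣? n) ≡ a
    ∑-𝟙-∣-∥ {a} {n} p^a∥n E a≤E = begin
      ∑[ e < E ] 𝟙 (p ^ suc e ∣? n) ≡⟨ ∑-cong E (λ {e} _ → 𝟙-cong (p ^ suc e ∣? n) (e <? a) (∥⇒^∣⇔≤ p^a∥n (suc e))) ⟩
      ∑[ e < E ] 𝟙 (e <? a)         ≡⟨ ∑-𝟙-< a E ⟩
      E ⊓ a                         ≡⟨ m≥n⇒m⊓n≡n a≤E ⟩
      a                             ∎
      where open ≡-Reasoning

    ∥-∏ : ∀ (f : ℕ → ℕ) E k → (∀ {j} → j < k → f j ≢ 0) → (∀ {j} → j < k → f j ≤ E) →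
          p ^ (∑[ e < E ] ∑[ j < k ] 𝟙 (p ^ suc e ∣? f j)) ∥ ∏[ j < k ] f j
    ∥-∏ f E zero _ _ = subst (λ a → p ^ a ∥ 1) (sym (∑-zero E)) (∥-unit p∤1)
    ∥-∏ f E (suc k) f≢0 f≤E with ∥-exists (f k) (f≢0 ≤-refl)
    ... | a , p^a∥fk = subst (λ b → p ^ b ∥ ∏[ j < suc k ] f j) exponent
          (∥-* (∥-∏ f E k (f≢0 ∘ m<n⇒m<1+n) (f≤E ∘ m<n⇒m<1+n)) p^a∥fk)
      where
      exponent : ∑[ e < E ] ∑[ j < k ] 𝟙 (p ^ suc e ∣? f j) + a ≡ ∑[ e < E ] ∑[ j < suc k ] 𝟙 (p ^ suc e ∣? f j)
      exponent = begin
        ∑[ e < E ] ∑[ j < k ] 𝟙 (p ^ suc e ∣? f j) + a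
          ≡⟨ cong (∑[ e < E ] ∑[ j < k ] 𝟙 (p ^ suc e ∣? f j) +_)
               (sym (∑-𝟙-∣-∥ p^a∥fk E (≤-trans (∥⇒≤ p^a∥fk) (f≤E ≤-refl)))) ⟩
        ∑[ e < E ] ∑[ j < k ] 𝟙 (p ^ suc e ∣? f j) + ∑[ e < E ] 𝟙 (p ^ suc e ∣? f k)
          ≡⟨ sym (∑-+ E) ⟩
        ∑[ e < E ] ∑[ j < suc k ] 𝟙 (p ^ suc e ∣? f j) ∎
        where open ≡-Reasoning

  -- Multiples of M in an arithmetic progression

  module Residue (M : ℕ) .{{_ : NonZero M}} {c : ℕ} (c<M : c < M) where

    private
      window : ∀ t r → r ≤ M → ∑[ j < r + t * M ] 𝟙 (j % M ≟ c) ≡ t + 𝟙 (c <? r)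
      window zero zero _ = sym (𝟙-no (c <? 0) λ ())
      window (suc t) zero _ = begin
        ∑[ j < M + t * M ] 𝟙 (j % M ≟ c) ≡⟨ window t M ≤-refl ⟩
        t + 𝟙 (c <? M)                   ≡⟨ cong (t +_) (𝟙-yes (c <? M) c<M) ⟩
        t + 1                            ≡⟨ trans (+-comm t 1) (sym (+-identityʳ (suc t))) ⟩
        suc t + 0                        ≡⟨ cong (suc t +_) (sym (𝟙-no (c <? 0) λ ())) ⟩
        suc t + 𝟙 (c <? 0)               ∎
        where open ≡-Reasoning
      window t (suc r) r<M = begin
        ∑[ j < r + t * M ] 𝟙 (j % M ≟ c) + 𝟙 ((r + t * M) % M ≟ c)
          ≡⟨ cong₂ _+_ (window t r (<⇒≤ r<M)) (cong (λ x → 𝟙 (x ≟ c)) r[r+tM]%M≡r) ⟩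
        t + 𝟙 (c <? r) + 𝟙 (r ≟ c) ≡⟨ +-assoc t _ _ ⟩
        t + (𝟙 (c <? r) + 𝟙 (r ≟ c)) ≡⟨ cong (t +_) (𝟙-<-suc c r) ⟩
        t + 𝟙 (c <? suc r) ∎
        where
        open ≡-Reasoning
        r[r+tM]%M≡r : (r + t * M) % M ≡ r
        r[r+tM]%M≡r = trans ([m+kn]%n≡m%n r t M) (m<n⇒m%n≡m r<M)

    ∑-𝟙-%≡ : ∀ k → ∑[ j < k ] 𝟙 (j % M ≟ c) ≡ k / M + 𝟙 (c <? k % M)
    ∑-𝟙-%≡ k = trans (cong (λ k → ∑[ j < k ] 𝟙 (j % M ≟ c)) (m≡m%n+[m/n]*n k M))
                     (window (k / M) (k % M) (m%n≤n k M))

  hits : ℕ → ℕ → ℕ → ℕ → ℕ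
  hits M n d k = ∑[ j < k ] 𝟙 (M ∣? n + d * j)

  ∣⇒≡0 : ∀ {M x} → M ∣ x → x < M → x ≡ 0
  ∣⇒≡0 {x = zero} _ _ = refl
  ∣⇒≡0 {x = suc x} M∣x x<M = contradiction (∣⇒≤ M∣x) (<⇒≱ x<M)

  ∣∧<2*⇒≤ : ∀ {M x} → M ∣ x → x < 2 * M → x ≤ M
  ∣∧<2*⇒≤ {M} (divides q refl) qM<2M =
    ≤-trans (*-monoˡ-≤ M (<⇒≤pred (*-cancelʳ-< M q 2 qM<2M))) (≤-reflexive (*-identityˡ M))

  𝟙-<-pair-lower : ∀ {M c c′} r → 1 + c + c′ ≤ M → 𝟙 (M ≤? 2 * r) ≤ 𝟙 (c <? r) + 𝟙 (c′ <? r)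
  𝟙-<-pair-lower {M} {c} {c′} r 1+c+c′≤M with M ≤? 2 * r | c <? r | c′ <? r
  ... | no _ | _ | _ = z≤n
  ... | yes _ | yes _ | _ = s≤s z≤n
  ... | yes _ | no _ | yes _ = ≤-refl
  ... | yes M≤2r | no c≮r | no c′≮r = contradiction (≤-trans 1+c+c′≤M M≤2r) (≤⇒≯ 2r≤c+c′)
    where
    2r≤c+c′ : 2 * r ≤ c + c′
    2r≤c+c′ = ≤-trans (≤-reflexive (cong (r +_) (+-identityʳ r))) (+-mono-≤ (≮⇒≥ c≮r) (≮⇒≥ c′≮r))

  𝟙-<-pair-upper : ∀ {M c c′} r → M ≤ 2 + c + c′ → 𝟙 (c <? r) + 𝟙 (c′ <? r) ≤ 1 + 𝟙 (M ≤? 2 * r)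
  𝟙-<-pair-upper {M} {c} {c′} r M≤2+c+c′ with c <? r | c′ <? r | M ≤? 2 * r
  ... | yes _ | yes _ | yes _ = ≤-refl
  ... | yes c<r | yes c′<r | no M≰2r = contradiction (≤-trans M≤2+c+c′ 2+c+c′≤2r) M≰2r
    where
    2+c+c′≤2r : 2 + c + c′ ≤ 2 * r
    2+c+c′≤2r = ≤-trans (≤-reflexive (sym (+-suc (suc c) c′)))
                  (≤-trans (+-mono-≤ c<r c′<r) (≤-reflexive (cong (r +_) (sym (+-identityʳ r)))))
  ... | yes _ | no _ | _ = s≤s z≤n
  ... | no _ | c′<?r | _ = ≤-trans (𝟙≤1 c′<?r) (s≤s z≤n)

  module Progression (M : ℕ) .{{_ : NonZero M}} {d : ℕ} (M⊥d : Coprime M d) where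

    ∣-%-invariant : ∀ n j → M ∣ n + d * j ⇔ M ∣ n + d * (j % M)
    ∣-%-invariant n j = mk⇔ (λ M∣ → ∣m+n∣m⇒∣n (subst (M ∣_) n+dj≡ M∣) (n∣m*n (d * (j / M))))
                            (λ M∣ → subst (M ∣_) (sym n+dj≡) (∣m∣n⇒∣m+n (n∣m*n (d * (j / M))) M∣))
      where
      n+dj≡ : n + d * j ≡ d * (j / M) * M + (n + d * (j % M))
      n+dj≡ = trans (cong (λ j → n + d * j) (m≡m%n+[m/n]*n j M)) (shuffle n d (j % M) (j / M) M)
        where
        shuffle : ∀ n d r q M → n + d * (r + q * M) ≡ d * q * M + (n + d * r)
        shuffle = solve-∀

    private
      root-unique-≤ : ∀ {n c r} → c ≤ r → r < M → M ∣ n + d * c → M ∣ n + d * r → r ≡ c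
      root-unique-≤ {n} {c} {r} c≤r r<M M∣c M∣r = trans (sym (m∸n+n≡m c≤r)) (cong (_+ c) r∸c≡0)
        where
        shift : ∀ n d c t → n + d * (c + t) ≡ (n + d * c) + d * t
        shift = solve-∀
        n+dr≡ : n + d * r ≡ (n + d * c) + d * (r ∸ c)
        n+dr≡ = trans (cong (λ r → n + d * r) (sym (m+[n∸m]≡n c≤r))) (shift n d c (r ∸ c))
        r∸c≡0 : r ∸ c ≡ 0
        r∸c≡0 = ∣⇒≡0 (coprime-divisor M⊥d (∣m+n∣m⇒∣n (subst (M ∣_) n+dr≡ M∣r) M∣c))
                     (≤-<-trans (m∸n≤m r c) r<M)

    root-unique : ∀ {n c r} → c < M → r < M → M ∣ n + d * c → M ∣ n + d * r → r ≡ c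
    root-unique {c = c} {r} c<M r<M M∣c M∣r with ≤-total c r
    ... | inj₁ c≤r = root-unique-≤ c≤r r<M M∣c M∣r
    ... | inj₂ r≤c = sym (root-unique-≤ r≤c c<M M∣r M∣c)

    ∣⇔%≡root : ∀ {n c} → c < M → M ∣ n + d * c → ∀ j → M ∣ n + d * j ⇔ j % M ≡ c
    ∣⇔%≡root {n} {c} c<M M∣c j = mk⇔
      (λ M∣ → root-unique c<M (m%n<n j M) M∣c (Equivalence.to (∣-%-invariant n j) M∣))
      (λ { refl → Equivalence.from (∣-%-invariant n j) M∣c })

    hits≡ : ∀ {n c} → c < M → M ∣ n + d * c → ∀ k → hits M n d k ≡ k / M + 𝟙 (c <? k % M)
    hits≡ {n} {c} c<M M∣c k = begin
      ∑[ j < k ] 𝟙 (M ∣? n + d * j) ≡⟨ ∑-cong k (λ {j} _ → 𝟙-cong _ _ (∣⇔%≡root c<M M∣c j)) ⟩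
      ∑[ j < k ] 𝟙 (j % M ≟ c)       ≡⟨ Residue.∑-𝟙-%≡ M c<M k ⟩
      k / M + 𝟙 (c <? k % M)         ∎
      where open ≡-Reasoning

    minus-inverse : ∃[ e ] M ∣ 1 + d * e
    minus-inverse with coprime-Bézout M⊥d
    ... | Bézout.+- x y 1+yd≡xM = y , divides x (trans (cong (1 +_) (*-comm d y)) 1+yd≡xM)
    ... | Bézout.-+ x y 1+xM≡yd = y * pred M , subst (λ M → M ∣ 1 + d * (y * pred M)) (suc-pred M) M∣
      where
      expand : ∀ d x y m → 1 + x * suc m ≡ y * d → 1 + d * (y * m) ≡ (1 + x * m) * suc m
      expand d x y m eq = begin
        1 + d * (y * m)          ≡⟨ reassociate d y m ⟩
        1 + y * d * m            ≡⟨ cong (λ z → 1 + z * m) (sym eq) ⟩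
        1 + (1 + x * suc m) * m  ≡⟨ factorise x m ⟩
        (1 + x * m) * suc m      ∎
        where
        open ≡-Reasoning
        reassociate : ∀ d y m → 1 + d * (y * m) ≡ 1 + y * d * m
        reassociate = solve-∀
        factorise : ∀ x m → 1 + (1 + x * suc m) * m ≡ (1 + x * m) * suc m
        factorise = solve-∀
      M∣ : suc (pred M) ∣ 1 + d * (y * pred M)
      M∣ = divides (1 + x * pred M) (expand d x y (pred M) (subst (λ M → 1 + x * M ≡ y * d) (sym (suc-pred M)) 1+xM≡yd))

    root : ∀ n → ∃[ c ] c < M × M ∣ n + d * c
    root n with minus-inverse
    ... | e , M∣1+de = (n * e) % M , m%n<n (n * e) M , Equivalence.to (∣-%-invariant n (n * e)) M∣
      where
      M∣ : M ∣ n + d * (n * e)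
      M∣ = subst (M ∣_) (factor n d e) (∣n⇒∣m*n n M∣1+de)
        where
        factor : ∀ n d e → n * (1 + d * e) ≡ n + d * (n * e)
        factor = solve-∀

    ∣-pair : ∀ {n n′ c c′ m} → M ∣ n + d * c → M ∣ n′ + d * c′ → n + n′ ≡ d * m → M ∣ m + c + c′
    ∣-pair {n} {n′} {c} {c′} {m} M∣c M∣c′ n+n′≡dm =
      coprime-divisor M⊥d (subst (M ∣_) sum≡ (∣m∣n⇒∣m+n M∣c M∣c′))
      where
      sum≡ : n + d * c + (n′ + d * c′) ≡ d * (m + c + c′)
      sum≡ = begin
        n + d * c + (n′ + d * c′) ≡⟨ collect n n′ d c c′ ⟩
        (n + n′) + d * (c + c′)   ≡⟨ cong (_+ d * (c + c′)) n+n′≡dm ⟩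
        d * m + d * (c + c′)      ≡⟨ factorise d m c c′ ⟩
        d * (m + c + c′)          ∎
        where
        open ≡-Reasoning
        collect : ∀ n n′ d c c′ → n + d * c + (n′ + d * c′) ≡ (n + n′) + d * (c + c′)
        collect = solve-∀
        factorise : ∀ d m c c′ → d * m + d * (c + c′) ≡ d * (m + c + c′)
        factorise = solve-∀

    private
      hits-pair≡ : ∀ {n n′ c c′} → c < M → M ∣ n + d * c → c′ < M → M ∣ n′ + d * c′ → ∀ k →
                   hits M n d k + hits M n′ d k ≡ 2 * (k / M) + (𝟙 (c <? k % M) + 𝟙 (c′ <? k % M))
      hits-pair≡ c<M M∣c c′<M M∣c′ k =
        trans (cong₂ _+_ (hits≡ c<M M∣c k) (hits≡ c′<M M∣c′ k)) (regroup (k / M) _ _)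
        where
        regroup : ∀ t x y → t + x + (t + y) ≡ 2 * t + (x + y)
        regroup = solve-∀

    k/M≤hits : ∀ n k → k / M ≤ hits M n d k
    k/M≤hits n k = let c , c<M , M∣c = root n in
      subst (k / M ≤_) (sym (hits≡ c<M M∣c k)) (m≤m+n (k / M) (𝟙 (c <? k % M)))

    -- Pairing r with 1 - r (q with 2 - q) forces c + c′ + 1 ≡ 0 (c + c′ + 2 ≡ 0) mod M on the roots, and whether
    -- k mod M reaches M/2 then decides how many of the two roots lie below it.
    hits-pair-lower : ∀ {n n′} k → n + n′ ≡ d →
                      2 * (k / M) + 𝟙 (M ≤? 2 * (k % M)) ≤ hits M n d k + hits M n′ d k
    hits-pair-lower {n} {n′} k n+n′≡d = lower (root n) (root n′)
      where
      lower : (∃[ c ] c < M × M ∣ n + d * c) → (∃[ c′ ] c′ < M × M ∣ n′ + d * c′) →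
              2 * (k / M) + 𝟙 (M ≤? 2 * (k % M)) ≤ hits M n d k + hits M n′ d k
      lower (c , c<M , M∣c) (c′ , c′<M , M∣c′) =
        subst (2 * (k / M) + 𝟙 (M ≤? 2 * (k % M)) ≤_) (sym (hits-pair≡ c<M M∣c c′<M M∣c′ k))
          (+-monoʳ-≤ (2 * (k / M)) (𝟙-<-pair-lower (k % M) 1+c+c′≤M))
        where
        1+c+c′<2M : 1 + c + c′ < 2 * M
        1+c+c′<2M = subst (1 + c + c′ <_) (cong (M +_) (sym (+-identityʳ M))) (+-mono-≤-< c<M c′<M)
        1+c+c′≤M : 1 + c + c′ ≤ M
        1+c+c′≤M = ∣∧<2*⇒≤ (∣-pair M∣c M∣c′ (trans n+n′≡d (sym (*-identityʳ d)))) 1+c+c′<2M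

    hits-pair-upper : ∀ {n n′} k → n + n′ ≡ 2 * d →
                      hits M n d k + hits M n′ d k ≤ 2 * (k / M) + (1 + 𝟙 (M ≤? 2 * (k % M)))
    hits-pair-upper {n} {n′} k n+n′≡2d = upper (root n) (root n′)
      where
      upper : (∃[ c ] c < M × M ∣ n + d * c) → (∃[ c′ ] c′ < M × M ∣ n′ + d * c′) →
              hits M n d k + hits M n′ d k ≤ 2 * (k / M) + (1 + 𝟙 (M ≤? 2 * (k % M)))
      upper (c , c<M , M∣c) (c′ , c′<M , M∣c′) =
        subst (_≤ 2 * (k / M) + (1 + 𝟙 (M ≤? 2 * (k % M)))) (sym (hits-pair≡ c<M M∣c c′<M M∣c′ k))
          (+-monoʳ-≤ (2 * (k / M)) (𝟙-<-pair-upper (k % M) M≤2+c+c′))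
        where
        M≤2+c+c′ : M ≤ 2 + c + c′
        M≤2+c+c′ = ∣⇒≤ (∣-pair M∣c M∣c′ (trans n+n′≡2d (*-comm 2 d)))

  hits-unit : ∀ M .{{_ : NonZero M}} k → hits M 1 1 k ≡ k / M
  hits-unit M k = begin
    hits M 1 1 k                 ≡⟨ Progression.hits≡ M (Coprimality.sym (1-coprimeTo M)) {n = 1}
                                      (≤-reflexive (suc-pred M)) M∣1+pred[M] k ⟩
    k / M + 𝟙 (pred M <? k % M)  ≡⟨ cong (k / M +_) (𝟙-no (pred M <? k % M) (≤⇒≯ (<⇒≤pred (m%n<n k M)))) ⟩
    k / M + 0                    ≡⟨ +-identityʳ (k / M) ⟩
    k / M                        ∎
    where
    open ≡-Reasoning
    M∣1+pred[M] : M ∣ 1 + 1 * pred M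
    M∣1+pred[M] = subst (M ∣_) (sym (trans (cong suc (*-identityˡ (pred M))) (suc-pred M))) ∣-refl

  hits-vanish : ∀ {M n d} k → 0 < n → (∀ {j} → j < k → n + d * j < M) → hits M n d k ≡ 0
  hits-vanish {M} {n} {d} k 0<n n+dj<M = trans (∑-cong k no-hit) (∑-zero k)
    where
    no-hit : ∀ {j} → j < k → 𝟙 (M ∣? n + d * j) ≡ 0
    no-hit {j} j<k = 𝟙-no (M ∣? n + d * j) λ M∣ →
      <⇒≢ (≤-trans 0<n (m≤m+n n (d * j))) (sym (∣⇒≡0 M∣ (n+dj<M j<k)))

  coprime-*ˡ : ∀ {a b c} → Coprime a c → Coprime b c → Coprime (a * b) c
  coprime-*ˡ {a} {b} {c} a⊥c b⊥c {x} (x∣ab , x∣c) = b⊥c (coprime-divisor x⊥a x∣ab , x∣c)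
    where
    x⊥a : Coprime x a
    x⊥a (y∣x , y∣a) = a⊥c (y∣a , ∣-trans y∣x x∣c)

  coprime-^ˡ : ∀ {m n} → Coprime m n → ∀ k → Coprime (m ^ k) n
  coprime-^ˡ {n = n} m⊥n zero = 1-coprimeTo n
  coprime-^ˡ m⊥n (suc k) = coprime-*ˡ m⊥n (coprime-^ˡ m⊥n k)

  -- The valuation bound

  rising : ℕ → ℕ → ℕ → ℕ
  rising n d k = ∏[ j < k ] (n + d * j)

  -- Boolean side conditions, so that they are proved by _ for numerals.
  record Small (n d : ℕ) : Set where
    field
      0<n : T (0 <ᵇ n)
      n≤7 : T (n ≤ᵇ 7)
      0<d : T (0 <ᵇ d)
      d≤6 : T (d ≤ᵇ 6)

  small-unit : Small 1 1
  small-unit = _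

  module _ {n d : ℕ} (small : Small n d) where
    open Small small

    small-positive : 0 < n
    small-positive = <ᵇ⇒< 0 n 0<n

    small-coprime : ∀ {p} → Prime p → 7 ≤ p → Coprime d p
    small-coprime p-prime 7≤p =
      Coprimality.sym (prime⇒coprime p-prime {{>-nonZero (<ᵇ⇒< 0 d 0<d)}} (≤-<-trans (≤ᵇ⇒≤ d 6 d≤6) 7≤p))

    small-term≤ : ∀ {j k} → j ≤ k → n + d * j ≤ 7 + 6 * k
    small-term≤ j≤k = +-mono-≤ (≤ᵇ⇒≤ n 7 n≤7) (*-mono-≤ (≤ᵇ⇒≤ d 6 d≤6) j≤k)

    small-term< : ∀ {j P} → j < P → 2 ≤ P → n + d * j < 7 * P
    small-term< {j} {P} j<P 2≤P = begin-strict
      n + d * j      ≤⟨ small-term≤ ≤-refl ⟩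
      7 + 6 * j      ≡⟨ cong suc (sym (*-suc 6 j)) ⟩
      1 + 6 * suc j  ≤⟨ +-monoʳ-≤ 1 (*-monoʳ-≤ 6 j<P) ⟩
      1 + 6 * P      <⟨ +-monoˡ-< (6 * P) 2≤P ⟩
      P + 6 * P      ≡⟨⟩
      7 * P          ∎
      where open ≤-Reasoning

  -- r₁ = a₁/d₁, 1 - r₁ = a₁′/d₁, r₂ = a₂/d₂, 1 - r₂ = a₂′/d₂, q = b/e and 2 - q = b′/e.
  record Parameters : Set where
    constructor mkParameters
    field
      a₁ a₁′ d₁ a₂ a₂′ d₂ b b′ e : ℕ
      a₁+a₁′≡d₁ : a₁ + a₁′ ≡ d₁
      b+b′≡2e : b + b′ ≡ 2 * e
      small-a₁ : Small a₁ d₁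
      small-a₁′ : Small a₁′ d₁
      small-a₂ : Small a₂ d₂
      small-a₂′ : Small a₂′ d₂
      small-b : Small b e
      small-b′ : Small b′ e

    numerator denominator : ℕ → ℕ
    numerator k = rising a₁ d₁ k * rising a₁′ d₁ k * rising a₂ d₂ k * rising a₂′ d₂ k
    denominator k = rising 1 1 k * rising 1 1 k * rising b e k * rising b′ e k

    numeratorHits denominatorHits : ℕ → ℕ → ℕ
    numeratorHits M k = hits M a₁ d₁ k + hits M a₁′ d₁ k + hits M a₂ d₂ k + hits M a₂′ d₂ k
    denominatorHits M k = hits M 1 1 k + hits M 1 1 k + hits M b e k + hits M b′ e k

    denominatorHits≤numeratorHits+1 : ∀ M .{{_ : NonZero M}} → Coprime M d₁ → Coprime M d₂ → Coprime M e →
                                      ∀ k → denominatorHits M k ≤ numeratorHits M k + 1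
    denominatorHits≤numeratorHits+1 M M⊥d₁ M⊥d₂ M⊥e k = begin
      hits M 1 1 k + hits M 1 1 k + hits M b e k + hits M b′ e k
        ≡⟨ cong (λ h → h + h + hits M b e k + hits M b′ e k) (hits-unit M k) ⟩
      t + t + hits M b e k + hits M b′ e k
        ≡⟨ +-assoc (t + t) _ _ ⟩
      t + t + (hits M b e k + hits M b′ e k)
        ≤⟨ +-monoʳ-≤ (t + t) (Progression.hits-pair-upper M M⊥e k b+b′≡2e) ⟩
      t + t + (2 * t + (1 + w))
        ≡⟨ regroup t w ⟩
      2 * t + w + t + t + 1
        ≤⟨ +-monoˡ-≤ 1 (+-mono-≤ (+-mono-≤ (Progression.hits-pair-lower M M⊥d₁ k a₁+a₁′≡d₁)
                                           (Progression.k/M≤hits M M⊥d₂ a₂ k))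
                                (Progression.k/M≤hits M M⊥d₂ a₂′ k)) ⟩
      hits M a₁ d₁ k + hits M a₁′ d₁ k + hits M a₂ d₂ k + hits M a₂′ d₂ k + 1 ∎
      where
      open ≤-Reasoning
      t = k / M
      w = 𝟙 (M ≤? 2 * (k % M))
      regroup : ∀ t w → t + t + (2 * t + (1 + w)) ≡ 2 * t + w + t + t + 1
      regroup = solve-∀

  module Valuation (P : Parameters) {p} (p-prime : Prime p) (7≤p : 7 ≤ p)
                   {s} (1≤s : 1 ≤ s) {k} (k<p^s : k < p ^ s) where
    open Parameters P
    open ExactPower p-prime

    private instance
      p-nonZero : NonZero p
      p-nonZero = nonTrivial⇒nonZero p {{prime⇒nonTrivial p-prime}}

    -- bounds every factor n + d j, hence every exponent of p in it
    E : ℕ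
    E = 7 + 6 * k

    ∥-rising : ∀ {n d} → Small n d → p ^ (∑[ e < E ] hits (p ^ suc e) n d k) ∥ rising n d k
    ∥-rising {n} {d} small = ∥-∏ (λ j → n + d * j) E k
      (λ _ → >⇒≢ (≤-trans (small-positive small) (m≤m+n n (d * _))))
      (λ j<k → small-term≤ small (<⇒≤ j<k))

    ∥-numerator : p ^ (∑[ e < E ] numeratorHits (p ^ suc e) k) ∥ numerator k
    ∥-numerator = subst (λ x → p ^ x ∥ numerator k) (sym (∑-+₄ E _ _ _ _))
      (∥-* (∥-* (∥-* (∥-rising small-a₁) (∥-rising small-a₁′)) (∥-rising small-a₂)) (∥-rising small-a₂′))

    ∥-denominator : p ^ (∑[ e < E ] denominatorHits (p ^ suc e) k) ∥ denominator k
    ∥-denominator = subst (λ x → p ^ x ∥ denominator k) (sym (∑-+₄ E _ _ _ _))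
      (∥-* (∥-* (∥-* (∥-rising small-unit) (∥-rising small-unit)) (∥-rising small-b)) (∥-rising small-b′))

    level-bound : ∀ e → denominatorHits (p ^ suc e) k ≤ numeratorHits (p ^ suc e) k + 𝟙 (e <? s)
    level-bound e with e <? s
    ... | yes _ = denominatorHits≤numeratorHits+1 (p ^ suc e) {{m^n≢0 p (suc e)}}
                    (coprime small-a₁) (coprime small-a₂) (coprime small-b) k
      where
      coprime : ∀ {n d} → Small n d → Coprime (p ^ suc e) d
      coprime small = coprime-^ˡ (Coprimality.sym (small-coprime small p-prime 7≤p)) (suc e)
    ... | no e≮s = subst (_≤ numeratorHits (p ^ suc e) k + 0) (sym vanish) z≤n
      where
      2≤p^s : 2 ≤ p ^ s
      2≤p^s = ≤-trans (≤-trans (s≤s (s≤s z≤n)) 7≤p)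
                (≤-trans (≤-reflexive (sym (*-identityʳ p))) (^-monoʳ-≤ p 1≤s))
      term< : ∀ {n d} → Small n d → ∀ {j} → j < k → n + d * j < p ^ suc e
      term< {n} {d} small {j} j<k = begin-strict
        n + d * j   <⟨ small-term< small (<-trans j<k k<p^s) 2≤p^s ⟩
        7 * p ^ s   ≤⟨ *-monoˡ-≤ (p ^ s) 7≤p ⟩
        p ^ suc s   ≤⟨ ^-monoʳ-≤ p (s≤s (≮⇒≥ e≮s)) ⟩
        p ^ suc e   ∎
        where open ≤-Reasoning
      vanishes : ∀ {n d} → Small n d → hits (p ^ suc e) n d k ≡ 0
      vanishes {n} {d} small = hits-vanish {p ^ suc e} {n} {d} k (small-positive small) (term< small)
      vanish : denominatorHits (p ^ suc e) k ≡ 0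
      vanish = cong₂ _+_ (cong₂ _+_ (cong₂ _+_ (vanishes small-unit) (vanishes small-unit)) (vanishes small-b))
                         (vanishes small-b′)

    exponent-bound : ∑[ e < E ] denominatorHits (p ^ suc e) k ≤ s + ∑[ e < E ] numeratorHits (p ^ suc e) k
    exponent-bound = begin
      ∑[ e < E ] denominatorHits (p ^ suc e) k                  ≤⟨ ∑-mono-≤ E (λ {e} _ → level-bound e) ⟩
      ∑[ e < E ] (numeratorHits (p ^ suc e) k + 𝟙 (e <? s))     ≡⟨ ∑-+ E ⟩
      ∑[ e < E ] numeratorHits (p ^ suc e) k + ∑[ e < E ] 𝟙 (e <? s)
                                                                ≡⟨ cong (_ +_) (∑-𝟙-< s E) ⟩
      ∑[ e < E ] numeratorHits (p ^ suc e) k + E ⊓ s            ≤⟨ +-monoʳ-≤ _ (m⊓n≤n E s) ⟩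
      ∑[ e < E ] numeratorHits (p ^ suc e) k + s                ≡⟨ +-comm _ s ⟩
      s + ∑[ e < E ] numeratorHits (p ^ suc e) k                ∎
      where open ≤-Reasoning

    ∥-denominator⇒∣ : p ^ (∑[ e < E ] denominatorHits (p ^ suc e) k) ∣ p ^ s * numerator k
    ∥-denominator⇒∣ = ∣-trans (^-monoʳ-∣ p exponent-bound)
      (subst (_∣ p ^ s * numerator k) (sym (^-distribˡ-+-* p s _)) (*-monoʳ-∣ (p ^ s) (∥⇒∣ ∥-numerator)))

open Arithmetic

open import Data.Nat as ℕ using (ℕ; zero; suc; _≤_; _<_; _^_; nonTrivial⇒≢1)
import Data.Nat.Properties as ℕ
open import Algebra.Properties.CommutativeSemigroup ℕ.*-commutativeSemigroup
  using () renaming (x∙yz≈y∙xz to ℕ-*-left-commute)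
open import Data.Nat.Divisibility using (_∣_; _∤_; divides; ∣-trans; ∣-refl; m∣m*n; *-monoʳ-∣)
open import Data.Nat.Coprimality as Coprimality using (Coprime; coprime-divisor)
open import Data.Nat.Primality using (Prime; euclidsLemma; prime⇒nonZero; prime⇒nonTrivial)
open import Data.Integer as ℤ using (+_)
import Data.Integer.Properties as ℤ
open import Data.Rational using (ℚ; mkℚ; ↧ₙ_; ↧_; _+_; _-_; _*_; _/_; 1/_; 0ℚ; 1ℚ; toℚᵘ; NonZero; ≢-nonZero)
open import Data.Rational.Properties
  using (_≟_; ↧-+; toℚᵘ-injective; toℚᵘ-fromℚᵘ; toℚᵘ-cong; toℚᵘ-homo-+; toℚᵘ-homo-*;
         *-assoc; *-identityˡ; *-inverseˡ; *-zeroˡ; *-zeroʳ; *-distribˡ-+; *-distribʳ-+; *-1-commutativeMonoid)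
open import Data.Rational.Unnormalised as ℚᵘ using (mkℚᵘ; *≡*)
import Data.Rational.Unnormalised.Properties as ℚᵘ
open import Data.Rational.Solver using (module +-*-Solver)
open +-*-Solver using (solve; _:=_; _:*_)
open import Algebra.Bundles using (CommutativeMonoid)
open import Algebra.Properties.CommutativeSemigroup (CommutativeMonoid.commutativeSemigroup *-1-commutativeMonoid)
  using () renaming (interchange to *-interchange; x∙yz≈y∙xz to *-left-commute)
open import Data.Product using (_×_; _,_)
open import Data.Sum using ([_,_]′)
open import Data.List.Membership.Propositional using (_∈_)
open import Data.List.Relation.Unary.Any using (here; there)
open import Function using (_∘_)
open import Relation.Nullary using (yes; no; contradiction)
open import Relation.Binary.PropositionalEquality

-- Rationals as fractions of natural numbers

toℚᵘ-ℕtoℚ : ∀ n → toℚᵘ (ℕtoℚ n) ℚᵘ.≃ mkℚᵘ (+ n) 0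
toℚᵘ-ℕtoℚ n = toℚᵘ-fromℚᵘ (mkℚᵘ (+ n) 0)

ℕtoℚ-+ : ∀ m n → ℕtoℚ (m ℕ.+ n) ≡ ℕtoℚ m + ℕtoℚ n
ℕtoℚ-+ m n = toℚᵘ-injective (begin
  toℚᵘ (ℕtoℚ (m ℕ.+ n))               ≈⟨ toℚᵘ-ℕtoℚ (m ℕ.+ n) ⟩
  mkℚᵘ (+ (m ℕ.+ n)) 0                ≈⟨ *≡* (cong (ℤ._* + 1) (trans (ℤ.pos-+ m n)
                                            (sym (cong₂ ℤ._+_ (ℤ.*-identityʳ (+ m)) (ℤ.*-identityʳ (+ n)))))) ⟩
  mkℚᵘ (+ m) 0 ℚᵘ.+ mkℚᵘ (+ n) 0      ≈⟨ ℚᵘ.+-cong (ℚᵘ.≃-sym (toℚᵘ-ℕtoℚ m)) (ℚᵘ.≃-sym (toℚᵘ-ℕtoℚ n)) ⟩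
  toℚᵘ (ℕtoℚ m) ℚᵘ.+ toℚᵘ (ℕtoℚ n)    ≈⟨ ℚᵘ.≃-sym (toℚᵘ-homo-+ (ℕtoℚ m) (ℕtoℚ n)) ⟩
  toℚᵘ (ℕtoℚ m + ℕtoℚ n)              ∎)
  where open ℚᵘ.≃-Reasoning

ℕtoℚ-* : ∀ m n → ℕtoℚ (m ℕ.* n) ≡ ℕtoℚ m * ℕtoℚ n
ℕtoℚ-* m n = toℚᵘ-injective (begin
  toℚᵘ (ℕtoℚ (m ℕ.* n))               ≈⟨ toℚᵘ-ℕtoℚ (m ℕ.* n) ⟩
  mkℚᵘ (+ (m ℕ.* n)) 0                ≈⟨ *≡* (cong (ℤ._* + 1) (ℤ.pos-* m n)) ⟩
  mkℚᵘ (+ m) 0 ℚᵘ.* mkℚᵘ (+ n) 0      ≈⟨ ℚᵘ.*-cong (ℚᵘ.≃-sym (toℚᵘ-ℕtoℚ m)) (ℚᵘ.≃-sym (toℚᵘ-ℕtoℚ n)) ⟩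
  toℚᵘ (ℕtoℚ m) ℚᵘ.* toℚᵘ (ℕtoℚ n)    ≈⟨ ℚᵘ.≃-sym (toℚᵘ-homo-* (ℕtoℚ m) (ℕtoℚ n)) ⟩
  toℚᵘ (ℕtoℚ m * ℕtoℚ n)              ∎)
  where open ℚᵘ.≃-Reasoning

ℕtoℚ-injective : ∀ {m n} → ℕtoℚ m ≡ ℕtoℚ n → m ≡ n
ℕtoℚ-injective {m} {n} eq with ℚᵘ.≃-trans (ℚᵘ.≃-sym (toℚᵘ-ℕtoℚ m)) (ℚᵘ.≃-trans (toℚᵘ-cong eq) (toℚᵘ-ℕtoℚ n))
... | *≡* m*1≡n*1 = ℤ.+-injective (ℤ.*-cancelʳ-≡ (+ m) (+ n) (+ 1) m*1≡n*1)

-- A record rather than the bare equation, so that A and B can be inferred: the unifier cannot invert ℕtoℚ.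
infix 4 _≐_/_

record _≐_/_ (x : ℚ) (A B : ℕ) : Set where
  constructor fraction
  field
    x*B≡A : x * ℕtoℚ B ≡ ℕtoℚ A

fraction-* : ∀ {x y A B C D} → x ≐ A / B → y ≐ C / D → x * y ≐ A ℕ.* C / B ℕ.* D
fraction-* {x} {y} {A} {B} {C} {D} (fraction x*B≡A) (fraction y*D≡C) = fraction (begin
  x * y * ℕtoℚ (B ℕ.* D)              ≡⟨ cong (x * y *_) (ℕtoℚ-* B D) ⟩
  x * y * (ℕtoℚ B * ℕtoℚ D)           ≡⟨ *-interchange x y (ℕtoℚ B) (ℕtoℚ D) ⟩
  (x * ℕtoℚ B) * (y * ℕtoℚ D)         ≡⟨ cong₂ _*_ x*B≡A y*D≡C ⟩
  ℕtoℚ A * ℕtoℚ C                     ≡⟨ ℕtoℚ-* A C ⟨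
  ℕtoℚ (A ℕ.* C)                      ∎)
  where open ≡-Reasoning

fraction-÷' : ∀ {x y A B C D} → x ≐ A / B → y ≐ C / D → C ≢ 0 → x ÷' y ≐ A ℕ.* D / B ℕ.* C
fraction-÷' {x} {y} {A} {B} {C} {D} (fraction x*B≡A) (fraction y*D≡C) C≢0 with y ≟ 0ℚ
... | yes refl = contradiction (ℕtoℚ-injective (trans (sym y*D≡C) (*-zeroˡ (ℕtoℚ D)))) C≢0
... | no y≢0 = fraction (begin
  x * y⁻¹ * ℕtoℚ (B ℕ.* C)              ≡⟨ cong (x * y⁻¹ *_) (trans (ℕtoℚ-* B C) (cong (ℕtoℚ B *_) (sym y*D≡C))) ⟩
  x * y⁻¹ * (ℕtoℚ B * (y * ℕtoℚ D))     ≡⟨ regroup x y⁻¹ (ℕtoℚ B) y (ℕtoℚ D) ⟩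
  (x * ℕtoℚ B) * ((y⁻¹ * y) * ℕtoℚ D)   ≡⟨ cong₂ (λ u v → u * (v * ℕtoℚ D)) x*B≡A (*-inverseˡ y) ⟩
  ℕtoℚ A * (1ℚ * ℕtoℚ D)                ≡⟨ cong (ℕtoℚ A *_) (*-identityˡ (ℕtoℚ D)) ⟩
  ℕtoℚ A * ℕtoℚ D                       ≡⟨ ℕtoℚ-* A D ⟨
  ℕtoℚ (A ℕ.* D)                        ∎)
  where
  open ≡-Reasoning
  instance
    y-nonZero : NonZero y
    y-nonZero = ≢-nonZero y≢0
  y⁻¹ = 1/ y
  regroup : ∀ x i b y d → x * i * (b * (y * d)) ≡ (x * b) * ((i * y) * d)
  regroup = solve 5 (λ x i b y d → x :* i :* (b :* (y :* d)) := (x :* b) :* ((i :* y) :* d)) refl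

fraction-scale : ∀ {x A B} m → x ≐ A / B → ℕtoℚ m * x ≐ m ℕ.* A / B
fraction-scale {x} {A} {B} m (fraction x*B≡A) = fraction (begin
  ℕtoℚ m * x * ℕtoℚ B      ≡⟨ *-assoc (ℕtoℚ m) x (ℕtoℚ B) ⟩
  ℕtoℚ m * (x * ℕtoℚ B)    ≡⟨ cong (ℕtoℚ m *_) x*B≡A ⟩
  ℕtoℚ m * ℕtoℚ A          ≡⟨ ℕtoℚ-* m A ⟨
  ℕtoℚ (m ℕ.* A)           ∎)
  where open ≡-Reasoning

fraction-poch : ∀ {x n d} → x ≐ n / d → ∀ k → poch x k ≐ rising n d k / d ℕ.^ k
fraction-poch x≐n/d zero = fraction refl
fraction-poch {x} {n} {d} x≐n/d@(fraction x*d≡n) (suc k) =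
  subst (poch x (suc k) ≐ rising n d (suc k) /_) (ℕ.*-comm (d ℕ.^ k) d)
    (fraction-* (fraction-poch x≐n/d k) (fraction shifted))
  where
  open ≡-Reasoning
  shifted : (x + ℕtoℚ k) * ℕtoℚ d ≡ ℕtoℚ (n ℕ.+ d ℕ.* k)
  shifted = begin
    (x + ℕtoℚ k) * ℕtoℚ d           ≡⟨ *-distribʳ-+ (ℕtoℚ d) x (ℕtoℚ k) ⟩
    x * ℕtoℚ d + ℕtoℚ k * ℕtoℚ d    ≡⟨ cong₂ _+_ x*d≡n (sym (ℕtoℚ-* k d)) ⟩
    ℕtoℚ n + ℕtoℚ (k ℕ.* d)         ≡⟨ ℕtoℚ-+ n (k ℕ.* d) ⟨
    ℕtoℚ (n ℕ.+ k ℕ.* d)            ≡⟨ cong (λ m → ℕtoℚ (n ℕ.+ m)) (ℕ.*-comm k d) ⟩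
    ℕtoℚ (n ℕ.+ d ℕ.* k)            ∎

*-cancelˡ : ∀ {z u v} → z ≢ 0ℚ → z * u ≡ z * v → u ≡ v
*-cancelˡ {z} {u} {v} z≢0 zu≡zv = begin
  u                  ≡⟨ *-identityˡ u ⟨
  1ℚ * u             ≡⟨ cong (_* u) (*-inverseˡ z) ⟨
  z⁻¹ * z * u        ≡⟨ *-assoc z⁻¹ z u ⟩
  z⁻¹ * (z * u)      ≡⟨ cong (z⁻¹ *_) zu≡zv ⟩
  z⁻¹ * (z * v)      ≡⟨ *-assoc z⁻¹ z v ⟨
  z⁻¹ * z * v        ≡⟨ cong (_* v) (*-inverseˡ z) ⟩
  1ℚ * v             ≡⟨ *-identityˡ v ⟩
  v                  ∎
  where
  open ≡-Reasoning
  instance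
    z-nonZero : NonZero z
    z-nonZero = ≢-nonZero z≢0
  z⁻¹ = 1/ z

fraction-cancel : ∀ {x A B} m → m ≢ 0 → x ≐ m ℕ.* A / m ℕ.* B → x ≐ A / B
fraction-cancel {x} {A} {B} m m≢0 (fraction eq) = fraction (*-cancelˡ (m≢0 ∘ ℕtoℚ-injective) (begin
  ℕtoℚ m * (x * ℕtoℚ B)   ≡⟨ *-left-commute (ℕtoℚ m) x (ℕtoℚ B) ⟩
  x * (ℕtoℚ m * ℕtoℚ B)   ≡⟨ cong (x *_) (ℕtoℚ-* m B) ⟨
  x * ℕtoℚ (m ℕ.* B)      ≡⟨ eq ⟩
  ℕtoℚ (m ℕ.* A)          ≡⟨ ℕtoℚ-* m A ⟩
  ℕtoℚ m * ℕtoℚ A         ∎))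
  where open ≡-Reasoning

denominator∣ : ∀ {x A B} → x ≐ A / B → ↧ₙ x ∣ B
denominator∣ {x@(mkℚ n d n⊥d)} {A} {B} (fraction x*B≡A) =
  coprime-divisor (Coprimality.sym (Coprimality.recompute n⊥d)) (divides A ∣n∣*B≡A*[1+d])
  where
  cross : toℚᵘ x ℚᵘ.* mkℚᵘ (+ B) 0 ℚᵘ.≃ mkℚᵘ (+ A) 0
  cross = ℚᵘ.≃-trans (ℚᵘ.*-congˡ {toℚᵘ x} (ℚᵘ.≃-sym (toℚᵘ-ℕtoℚ B)))
            (ℚᵘ.≃-trans (ℚᵘ.≃-sym (toℚᵘ-homo-* x (ℕtoℚ B))) (ℚᵘ.≃-trans (toℚᵘ-cong x*B≡A) (toℚᵘ-ℕtoℚ A)))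
  n*B≡A*[1+d] : n ℤ.* + B ℤ.* + 1 ≡ + A ℤ.* + suc (d ℕ.* 1)
  n*B≡A*[1+d] with cross
  ... | *≡* eq = eq
  ∣n∣*B≡A*[1+d] : ℤ.∣ n ∣ ℕ.* B ≡ A ℕ.* suc d
  ∣n∣*B≡A*[1+d] = begin
    ℤ.∣ n ∣ ℕ.* B                     ≡⟨ ℕ.*-identityʳ _ ⟨
    ℤ.∣ n ∣ ℕ.* B ℕ.* 1               ≡⟨ cong (ℕ._* 1) (ℤ.abs-* n (+ B)) ⟨
    ℤ.∣ n ℤ.* + B ∣ ℕ.* 1             ≡⟨ ℤ.abs-* (n ℤ.* + B) (+ 1) ⟨
    ℤ.∣ n ℤ.* + B ℤ.* + 1 ∣           ≡⟨ cong ℤ.∣_∣ n*B≡A*[1+d] ⟩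
    ℤ.∣ + A ℤ.* + suc (d ℕ.* 1) ∣     ≡⟨ ℤ.abs-* (+ A) (+ suc (d ℕ.* 1)) ⟩
    A ℕ.* suc (d ℕ.* 1)               ≡⟨ cong (λ m → A ℕ.* suc m) (ℕ.*-identityʳ d) ⟩
    A ℕ.* suc d                       ∎
    where open ≡-Reasoning

fraction⇒∈ℤ : ∀ {p x A B} → x ≐ A / B → p ∤ B → x ∈ℤ[ p ]
fraction⇒∈ℤ x≐A/B p∤B p∣↧x = p∤B (∣-trans p∣↧x (denominator∣ x≐A/B))

∈ℤ-+ : ∀ {p x y} → Prime p → x ∈ℤ[ p ] → y ∈ℤ[ p ] → (x + y) ∈ℤ[ p ]
∈ℤ-+ {p} {x} {y} p-prime x∈ℤ y∈ℤ p∣↧[x+y] =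
  [ x∈ℤ , y∈ℤ ]′ (euclidsLemma (↧ₙ x) (↧ₙ y) p-prime (∣-trans p∣↧[x+y] ↧[x+y]∣↧x*↧y))
  where
  ↧[x+y]∣↧x*↧y : ↧ₙ (x + y) ∣ ↧ₙ x ℕ.* ↧ₙ y
  ↧[x+y]∣↧x*↧y = cofactor _ (↧-+ x y)
    where
    cofactor : ∀ g → ↧ (x + y) ℤ.* g ≡ ↧ x ℤ.* ↧ y → ↧ₙ (x + y) ∣ ↧ₙ x ℕ.* ↧ₙ y
    cofactor g eq = divides ℤ.∣ g ∣ (begin
      ↧ₙ x ℕ.* ↧ₙ y                ≡⟨ ℤ.abs-* (↧ x) (↧ y) ⟨
      ℤ.∣ ↧ x ℤ.* ↧ y ∣            ≡⟨ cong ℤ.∣_∣ eq ⟨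
      ℤ.∣ ↧ (x + y) ℤ.* g ∣        ≡⟨ ℤ.abs-* (↧ (x + y)) g ⟩
      ↧ₙ (x + y) ℕ.* ℤ.∣ g ∣       ≡⟨ ℕ.*-comm (↧ₙ (x + y)) ℤ.∣ g ∣ ⟩
      ℤ.∣ g ∣ ℕ.* ↧ₙ (x + y)       ∎)
      where open ≡-Reasoning

∈ℤ-criterion : ∀ {p a x A B D} → Prime p → x ≐ A / B ℕ.* D → p ∤ B → p ^ a ∥ D → p ^ a ∣ A → x ∈ℤ[ p ]
∈ℤ-criterion {p} {a} {x} {A} {B} {D} p-prime x≐A/BD p∤B (exactly u D≡p^a*u p∤u) (divides A′ A≡A′*p^a) =
  fraction⇒∈ℤ (fraction-cancel (p ^ a) p^a≢0 x≐p^aA′/p^aBu) ([ p∤B , p∤u ]′ ∘ euclidsLemma B u p-prime)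
  where
  p^a≢0 : p ^ a ≢ 0
  p^a≢0 = ℕ.≢-nonZero⁻¹ (p ^ a) {{ℕ.m^n≢0 p a {{prime⇒nonZero p-prime}}}}
  x≐p^aA′/p^aBu : x ≐ p ^ a ℕ.* A′ / p ^ a ℕ.* (B ℕ.* u)
  x≐p^aA′/p^aBu = subst₂ (λ A D → x ≐ A / D)
    (trans A≡A′*p^a (ℕ.*-comm A′ (p ^ a)))
    (trans (cong (B ℕ.*_) D≡p^a*u) (ℕ-*-left-commute B (p ^ a) u))
    x≐A/BD

∈ℤ-*-sumTo : ∀ {p} → Prime p → ∀ c f n → (∀ {j} → j ℕ.< n → (c * f j) ∈ℤ[ p ]) → (c * sumTo n f) ∈ℤ[ p ]
∈ℤ-*-sumTo {p} p-prime c f zero _ = subst (_∈ℤ[ p ]) (sym (*-zeroʳ c)) p∤1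
  where open ExactPower p-prime using (p∤1)
∈ℤ-*-sumTo p-prime c f (suc n) ∈ℤ = subst (_∈ℤ[ _ ]) (sym (*-distribˡ-+ c (sumTo n f) (f n)))
  (∈ℤ-+ {x = c * sumTo n f} {y = c * f n} p-prime (∈ℤ-*-sumTo p-prime c f n (∈ℤ ∘ ℕ.m<n⇒m<1+n)) (∈ℤ ℕ.≤-refl))

-- The hypergeometric terms

record Datum (r₁ r₂ q : ℚ) : Set where
  constructor mkDatum
  field
    parameters : Parameters
  open Parameters parameters public
  field
    r₁≐ : r₁ ≐ a₁ / d₁
    1-r₁≐ : 1ℚ - r₁ ≐ a₁′ / d₁
    r₂≐ : r₂ ≐ a₂ / d₂
    1-r₂≐ : 1ℚ - r₂ ≐ a₂′ / d₂
    q≐ : q ≐ b / e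
    2-q≐ : (+ 2) / 1 - q ≐ b′ / e

datum : ∀ {r₁ r₂ q} → (r₁ , r₂ , q) ∈ sixTuples → Datum r₁ r₂ q
datum (here refl) =
  mkDatum (mkParameters 1 1 2 1 1 2 4 2 3 refl refl _ _ _ _ _ _)
    (fraction refl) (fraction refl) (fraction refl) (fraction refl) (fraction refl) (fraction refl)
datum (there (here refl)) =
  mkDatum (mkParameters 1 1 2 1 1 2 7 5 6 refl refl _ _ _ _ _ _)
    (fraction refl) (fraction refl) (fraction refl) (fraction refl) (fraction refl) (fraction refl)
datum (there (there (here refl))) =
  mkDatum (mkParameters 1 1 2 1 2 3 7 5 6 refl refl _ _ _ _ _ _)
    (fraction refl) (fraction refl) (fraction refl) (fraction refl) (fraction refl) (fraction refl)
datum (there (there (there (here refl)))) =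
  mkDatum (mkParameters 1 1 2 1 2 3 5 3 4 refl refl _ _ _ _ _ _)
    (fraction refl) (fraction refl) (fraction refl) (fraction refl) (fraction refl) (fraction refl)
datum (there (there (there (there (here refl))))) =
  mkDatum (mkParameters 1 1 2 1 3 4 7 5 6 refl refl _ _ _ _ _ _)
    (fraction refl) (fraction refl) (fraction refl) (fraction refl) (fraction refl) (fraction refl)
datum (there (there (there (there (there (here refl)))))) =
  mkDatum (mkParameters 1 1 2 1 1 2 5 3 4 refl refl _ _ _ _ _ _)
    (fraction refl) (fraction refl) (fraction refl) (fraction refl) (fraction refl) (fraction refl)

module _ {r₁ r₂ q : ℚ} (D : Datum r₁ r₂ q) where
  open Datum D

  numeratorScale denominatorScale : ℕ → ℕ
  numeratorScale k = d₁ ℕ.^ k ℕ.* d₁ ℕ.^ k ℕ.* d₂ ℕ.^ k ℕ.* d₂ ℕ.^ k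
  denominatorScale k = 1 ℕ.^ k ℕ.* 1 ℕ.^ k ℕ.* e ℕ.^ k ℕ.* e ℕ.^ k

  H-fraction : ∀ k → denominator k ≢ 0 →
               H r₁ r₂ q k ≐ numerator k ℕ.* denominatorScale k / numeratorScale k ℕ.* denominator k
  H-fraction k = fraction-÷'
    (fraction-* (fraction-* (fraction-* (fraction-poch r₁≐ k) (fraction-poch 1-r₁≐ k)) (fraction-poch r₂≐ k))
                (fraction-poch 1-r₂≐ k))
    (fraction-* (fraction-* (fraction-* (fraction-poch 1≐ k) (fraction-poch 1≐ k)) (fraction-poch q≐ k))
                (fraction-poch 2-q≐ k))
    where
    1≐ : 1ℚ ≐ 1 / 1
    1≐ = fraction refl

  p^sH∈ℤ : ∀ {p s} → Prime p → 7 ≤ p → 1 ≤ s → ∀ {k} → k < p ^ s → (ℕtoℚ (p ^ s) * H r₁ r₂ q k) ∈ℤ[ p ]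
  p^sH∈ℤ {p} {s} p-prime 7≤p 1≤s {k} k<p^s =
    ∈ℤ-criterion p-prime (fraction-scale (p ^ s) (H-fraction k (∥⇒≢0 ∥-denominator))) p∤scale ∥-denominator
      (∣-trans ∥-denominator⇒∣ (*-monoʳ-∣ (p ^ s) (m∣m*n (denominatorScale k))))
    where
    open ExactPower p-prime using (∥⇒≢0)
    open Valuation parameters p-prime 7≤p 1≤s k<p^s
    coprime : ∀ {n d} → Small n d → Coprime (d ℕ.^ k) p
    coprime small = coprime-^ˡ (small-coprime small p-prime 7≤p) k
    scale⊥p : Coprime (numeratorScale k) p
    scale⊥p = coprime-*ˡ (coprime-*ˡ (coprime-*ˡ (coprime small-a₁) (coprime small-a₁′)) (coprime small-a₂))
                         (coprime small-a₂′)
    p∤scale : p ∤ numeratorScale k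
    p∤scale p∣ = nonTrivial⇒≢1 {{prime⇒nonTrivial p-prime}} (scale⊥p (p∣ , ∣-refl))

proposition3p5 : (p s : ℕ) → Prime p → 7 ≤ p → 1 ≤ s →
  (r₁ r₂ q : ℚ) → (r₁ , r₂ , q) ∈ sixTuples →
  ((k : ℕ) → k < p ^ s → (ℕtoℚ (p ^ s) * H r₁ r₂ q k) ∈ℤ[ p ])
  × ((ℕtoℚ (p ^ s) * F p s r₁ r₂ q) ∈ℤ[ p ])
proposition3p5 p s p-prime 7≤p 1≤s r₁ r₂ q tuple =
  (λ k → p^sH∈ℤ′) , ∈ℤ-*-sumTo p-prime (ℕtoℚ (p ^ s)) (H r₁ r₂ q) (p ^ s) p^sH∈ℤ′
  where
  p^sH∈ℤ′ : ∀ {k} → k < p ^ s → (ℕtoℚ (p ^ s) * H r₁ r₂ q k) ∈ℤ[ p ]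
  p^sH∈ℤ′ = p^sH∈ℤ (datum tuple) p-prime 7≤p 1≤s
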